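{- For every integer $k\geqslant 1$, let $T(k)$ be the rooted tree defined recursively as follows: $T(1)$ consists of a root $r$ and a single leaf adjacent to it; for $k>1$, set $k_1=\lceil k/2\rceil$ and $k_2=\lfloor k/2\rfloor$, take a path $P_1$ of length $k_1$ and a path $P_2$ of length $k_2$ sharing exactly one common end vertex, which is the root $r$; let $\lambda_i$ be the end of $P_i$ other than $r$; then for $i=1,2$ attach a copy of $T(k_i)$ at $\lambda_{3-i}$ by identifying $\lambda_{3-i}$ with the root of that copy. Then for all $k\geqslant 1$: (1) $T(k)$ has $O(k\log k)$ vertices (i.e., there is an absolute constant $C$ with $|V(T(k))| \leqslant C\,k\log(k+1)$ for all $k\geqslant1$); (2) $T(k)$ has exactly $k$ leaves; (3) every path from the root $r$ to a leaf has length $k$.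
   Context: The length of a path is its number of edges. A leaf of $T(k)$ is a non-root vertex of degree one. -}

module Defs where

open import Data.Nat using (ℕ; zero; suc; _+_; ⌊_/2⌋; ⌈_/2⌉)
open import Data.List using (List; []; _∷_; _++_)
open import Data.List.Membership.Propositional using (_∈_)

-- Finite rooted (unordered-in-spirit) trees: a vertex together with the
-- list of subtrees rooted at its children.
data Tree : Set where
  node : List Tree → Tree

children : Tree → List Tree
children (node cs) = cs

mutual
  size : Tree → ℕ
  size (node cs) = suc (sizes cs)

  sizes : List Tree → ℕ
  sizes []       = 0
  sizes (c ∷ cs) = size c + sizes cs

mutual
  childless : Tree → ℕ
  childless (node [])         = 1
  childless (node (c ∷ cs))   = childlesses (c ∷ cs)

  childlesses : List Tree → ℕ
  childlesses []       = 0
  childlesses (c ∷ cs) = childless c + childlesses cs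

-- Leaves of a rooted tree = non-root vertices of degree one
-- = non-root vertices without children.
leaves : Tree → ℕ
leaves (node cs) = childlesses cs

-- Desc t s n : s is (an occurrence of) the subtree rooted at a vertex
-- reached from the root of t by a downward path of length n.
-- In a tree this is exactly the (unique) path from the root to that vertex.
data Desc : Tree → Tree → ℕ → Set where
  here  : ∀ {t} → Desc t t 0
  there : ∀ {t c s n} → c ∈ children t → Desc c s n → Desc t s (suc n)


glue : Tree → Tree → Tree
glue (node cs) (node ds) = node (cs ++ ds)

stem : ℕ → Tree → Tree
stem zero    t = t
stem (suc n) t = node (stem n t ∷ [])

-- T k, defined with fuel (fuel k suffices for k ≥ 1 since
-- ⌈k/2⌉, ⌊k/2⌋ ≤ k - 1 for k ≥ 2).  Values at k = 0 are irrelevant.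
Tf : ℕ → ℕ → Tree
Tf zero    k = node []
Tf (suc f) zero = node []
Tf (suc f) (suc zero) = node (node [] ∷ [])
Tf (suc f) k@(suc (suc _)) =
  glue (stem ⌈ k /2⌉ (Tf f ⌊ k /2⌋)) (stem ⌊ k /2⌋ (Tf f ⌈ k /2⌉))

T : ℕ → Tree
T k = Tf k k

-- T k glues two stems of lengths ⌈k/2⌉ and ⌊k/2⌋, ending in T ⌊k/2⌋ and T ⌈k/2⌉ respectively, so
-- every leaf lies at depth ⌈k/2⌉ + ⌊k/2⌋ = k and the leaf counts add up to k.  For the size,
-- S(k) < k + S(⌊k/2⌋) + S(⌈k/2⌉), and since ⌈log₂(⌊k/2⌋+1)⌉ = ⌈log₂(k+1)⌉ − 1 the bound
-- S(k) ≤ 3k⌈log₂(k+1)⌉ propagates: the half ⌊k/2⌋ saves 3⌊k/2⌋ ≥ k, which pays for the stems.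
module Submission where

open import Defs
open import Data.Nat using (ℕ; suc; _+_; _*_; _≤_; _≥_)
open import Data.Nat.Logarithm using (⌈log₂_⌉)
open import Data.List using ([])
open import Data.Product using (Σ; _×_)
open import Relation.Binary.PropositionalEquality using (_≡_)

open import Data.Empty using (⊥-elim)
open import Data.List using (_∷_; _++_)
open import Data.List.Properties using (++-conicalˡ)
open import Data.List.Membership.Propositional.Properties using (∈-++⁻)
open import Data.List.Relation.Unary.Any using (here)
open import Data.Nat using (zero; _∸_; z≤n; s≤s; s≤s⁻¹; ⌊_/2⌋; ⌈_/2⌉)
open import Data.Nat.Logarithm using (⌈log₂⌉-mono-≤; ⌈log₂⌈n/2⌉⌉≡⌈log₂n⌉∸1)
open import Data.Nat.Properties
open import Data.Nat.Tactic.RingSolver using (solve-∀)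
open import Data.Product using (_,_)
open import Data.Sum using (inj₁; inj₂)
open import Relation.Binary.PropositionalEquality
  using (refl; sym; trans; cong; cong₂; subst; module ≡-Reasoning)

leaf : Tree
leaf = node []

sizes-++ : ∀ cs ds → sizes (cs ++ ds) ≡ sizes cs + sizes ds
sizes-++ []       ds = refl
sizes-++ (c ∷ cs) ds = trans (cong (size c +_) (sizes-++ cs ds)) (sym (+-assoc (size c) _ _))

size-glue : ∀ s t → suc (size (glue s t)) ≡ size s + size t
size-glue (node cs) (node ds) = begin
  suc (suc (sizes (cs ++ ds)))    ≡⟨ cong (λ n → suc (suc n)) (sizes-++ cs ds) ⟩
  suc (suc (sizes cs + sizes ds)) ≡⟨ cong suc (sym (+-suc (sizes cs) (sizes ds))) ⟩
  suc (sizes cs + suc (sizes ds)) ∎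
  where open ≡-Reasoning

size-stem : ∀ m t → size (stem m t) ≡ m + size t
size-stem zero    t = refl
size-stem (suc m) t = cong suc (trans (+-identityʳ _) (size-stem m t))

childless-stem : ∀ m t → childless (stem m t) ≡ childless t
childless-stem zero    t = refl
childless-stem (suc m) t = trans (+-identityʳ _) (childless-stem m t)

childless-glue-stems : ∀ a b x y →
  childless (glue (stem (suc a) x) (stem (suc b) y)) ≡ childless x + childless y
childless-glue-stems a b x y =
  cong₂ _+_ (childless-stem a x) (trans (+-identityʳ _) (childless-stem b y))

LeavesAtDepth : Tree → ℕ → Set
LeavesAtDepth t d = ∀ s n → Desc t s n → children s ≡ [] → n ≡ d

leaf-depth : LeavesAtDepth leaf 0
leaf-depth s .0 here        _ = refl
leaf-depth s _  (there () _) _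

stem-depth : ∀ m {t d} → LeavesAtDepth t d → LeavesAtDepth (stem m t) (m + d)
stem-depth zero    h = h
stem-depth (suc m) h s .0      here                 ()
stem-depth (suc m) h s (suc n) (there (here refl) p) e = cong suc (stem-depth m h s n p e)

glue-depth : ∀ {x y d} → LeavesAtDepth x d → LeavesAtDepth y d → LeavesAtDepth (glue x y) d
glue-depth {node cs} {node ds} hx hy s .0 here e = hx (node cs) 0 here (++-conicalˡ cs ds e)
glue-depth {node cs} {node ds} hx hy s (suc n) (there c∈cs++ds p) e with ∈-++⁻ cs c∈cs++ds
... | inj₁ c∈cs = hx s (suc n) (there c∈cs p) e
... | inj₂ c∈ds = hy s (suc n) (there c∈ds p) e

glue-stems-depth : ∀ {a b x y} → LeavesAtDepth x b → LeavesAtDepth y a →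
  LeavesAtDepth (glue (stem a x) (stem b y)) (a + b)
glue-stems-depth {a} {b} hx hy =
  glue-depth (stem-depth a hx) (subst (LeavesAtDepth _) (+-comm b a) (stem-depth b hy))

leaves≡childless : ∀ {t d} → LeavesAtDepth t d → d ≥ 1 → leaves t ≡ childless t
leaves≡childless {node []}      h d≥1 = ⊥-elim (<-irrefl (h leaf 0 here refl) d≥1)
leaves≡childless {node (_ ∷ _)} h d≥1 = refl

⌈n/2⌉+⌊n/2⌋≡n : ∀ n → ⌈ n /2⌉ + ⌊ n /2⌋ ≡ n
⌈n/2⌉+⌊n/2⌋≡n n = trans (+-comm ⌈ n /2⌉ ⌊ n /2⌋) (⌊n/2⌋+⌈n/2⌉≡n n)

T-induction : (P : ℕ → Tree → Set) → P 1 (stem 1 leaf) →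
  (∀ {k x y} → k ≥ 2 → P ⌊ k /2⌋ x → P ⌈ k /2⌉ y →
    P k (glue (stem ⌈ k /2⌉ x) (stem ⌊ k /2⌋ y))) →
  ∀ k → k ≥ 1 → P k (T k)
T-induction P base step k k≥1 = fuelled k k k≥1 ≤-refl
  where
  fuelled : ∀ f k → k ≥ 1 → k ≤ f → P k (Tf f k)
  fuelled zero    .(suc _)         (s≤s _) ()
  fuelled (suc f) (suc zero)       _       _      = base
  fuelled (suc f) k@(suc (suc m)) _       k≤1+f =
    step (s≤s (s≤s z≤n))
      (fuelled f ⌊ k /2⌋ (s≤s z≤n) (s≤s⁻¹ (≤-trans (⌊n/2⌋<n (suc m)) k≤1+f)))
      (fuelled f ⌈ k /2⌉ (s≤s z≤n) (s≤s⁻¹ (≤-trans (⌈n/2⌉<n m) k≤1+f)))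

T-depth : ∀ k → k ≥ 1 → LeavesAtDepth (T k) k
T-depth = T-induction (λ k t → LeavesAtDepth t k) (stem-depth 1 leaf-depth)
  λ {k} _ hx hy → subst (LeavesAtDepth _) (⌈n/2⌉+⌊n/2⌋≡n k) (glue-stems-depth hx hy)

T-childless : ∀ k → k ≥ 1 → childless (T k) ≡ k
T-childless = T-induction (λ k t → childless t ≡ k) refl step
  where
  step : ∀ {k x y} → k ≥ 2 → childless x ≡ ⌊ k /2⌋ → childless y ≡ ⌈ k /2⌉ →
    childless (glue (stem ⌈ k /2⌉ x) (stem ⌊ k /2⌋ y)) ≡ k
  step {x = x} {y} (s≤s (s≤s {n = m} _)) hx hy = begin
    childless (glue (stem ⌈ k /2⌉ x) (stem ⌊ k /2⌋ y)) ≡⟨ childless-glue-stems ⌈ m /2⌉ ⌊ m /2⌋ x y ⟩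
    childless x + childless y                           ≡⟨ cong₂ _+_ hx hy ⟩
    ⌊ k /2⌋ + ⌈ k /2⌉                                   ≡⟨ ⌊n/2⌋+⌈n/2⌉≡n k ⟩
    k                                                   ∎
    where open ≡-Reasoning
          k = suc (suc m)

T-leaves : ∀ k → k ≥ 1 → leaves (T k) ≡ k
T-leaves k k≥1 = trans (leaves≡childless (T-depth k k≥1) k≥1) (T-childless k k≥1)

bitLength : ℕ → ℕ
bitLength k = ⌈log₂ suc k ⌉

bitLength-mono-≤ : ∀ {m n} → m ≤ n → bitLength m ≤ bitLength n
bitLength-mono-≤ m≤n = ⌈log₂⌉-mono-≤ (s≤s m≤n)

-- ⌈ suc k /2⌉ reduces to suc ⌊ k /2⌋.
bitLength⌊n/2⌋≡bitLength∸1 : ∀ k → bitLength ⌊ k /2⌋ ≡ bitLength k ∸ 1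
bitLength⌊n/2⌋≡bitLength∸1 k = ⌈log₂⌈n/2⌉⌉≡⌈log₂n⌉∸1 (suc k)

⌈n/2⌉≤2⌊n/2⌋ : ∀ n → ⌈ 2 + n /2⌉ ≤ 2 * ⌊ 2 + n /2⌋
⌈n/2⌉≤2⌊n/2⌋ zero          = s≤s z≤n
⌈n/2⌉≤2⌊n/2⌋ (suc zero)    = ≤-refl
⌈n/2⌉≤2⌊n/2⌋ (suc (suc n)) =
  ≤-trans (s≤s (⌈n/2⌉≤2⌊n/2⌋ n))
    (≤-trans (n≤1+n _) (≤-reflexive (sym (*-suc 2 ⌊ 2 + n /2⌋))))

halving-cost : ∀ h c L → c ≤ 2 * h → L ≥ 1 →
  h + c + 3 * h * (L ∸ 1) + 3 * c * L ≤ 3 * (h + c) * L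
halving-cost h c (suc l) c≤2h _ = begin
  h + c + 3 * h * l + 3 * c * suc l     ≤⟨ +-monoˡ-≤ _ (+-monoˡ-≤ _ (+-monoʳ-≤ h c≤2h)) ⟩
  h + 2 * h + 3 * h * l + 3 * c * suc l ≡⟨ expand h c l ⟩
  3 * (h + c) * suc l                   ∎
  where
  open ≤-Reasoning
  expand : ∀ h c l → h + 2 * h + 3 * h * l + 3 * c * suc l ≡ 3 * (h + c) * suc l
  expand = solve-∀

size-glue-stems : ∀ a b x y →
  suc (size (glue (stem a x) (stem b y))) ≡ b + a + size x + size y
size-glue-stems a b x y = begin
  suc (size (glue (stem a x) (stem b y))) ≡⟨ size-glue (stem a x) (stem b y) ⟩
  size (stem a x) + size (stem b y)       ≡⟨ cong₂ _+_ (size-stem a x) (size-stem b y) ⟩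
  (a + size x) + (b + size y)             ≡⟨ rearrange a (size x) b (size y) ⟩
  b + a + size x + size y                 ∎
  where
  open ≡-Reasoning
  rearrange : ∀ a m b n → (a + m) + (b + n) ≡ b + a + m + n
  rearrange = solve-∀

T-size : ∀ k → k ≥ 1 → size (T k) ≤ 3 * k * bitLength k
T-size = T-induction (λ k t → size t ≤ 3 * k * bitLength k) (s≤s (s≤s z≤n)) step
  where
  step : ∀ {k x y} → k ≥ 2 →
    size x ≤ 3 * ⌊ k /2⌋ * bitLength ⌊ k /2⌋ → size y ≤ 3 * ⌈ k /2⌉ * bitLength ⌈ k /2⌉ →
    size (glue (stem ⌈ k /2⌉ x) (stem ⌊ k /2⌋ y)) ≤ 3 * k * bitLength k
  step {x = x} {y} (s≤s (s≤s {n = m} _)) hx hy = <⇒≤ (begin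
    suc (size (glue (stem c x) (stem h y))) ≡⟨ size-glue-stems c h x y ⟩
    h + c + size x + size y                 ≤⟨ +-mono-≤ (+-monoʳ-≤ (h + c) hx′) hy′ ⟩
    h + c + 3 * h * (L ∸ 1) + 3 * c * L     ≤⟨ halving-cost h c L (⌈n/2⌉≤2⌊n/2⌋ m) L≥1 ⟩
    3 * (h + c) * L                         ≡⟨ cong (λ n → 3 * n * L) (⌊n/2⌋+⌈n/2⌉≡n k) ⟩
    3 * k * L                               ∎)
    where
    open ≤-Reasoning
    k = suc (suc m)
    h = ⌊ k /2⌋
    c = ⌈ k /2⌉
    L = bitLength k
    L≥1 : L ≥ 1
    L≥1 = bitLength-mono-≤ {1} {k} (s≤s z≤n)
    hx′ : size x ≤ 3 * h * (L ∸ 1)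
    hx′ = subst (λ l → size x ≤ 3 * h * l) (bitLength⌊n/2⌋≡bitLength∸1 k) hx
    hy′ : size y ≤ 3 * c * L
    hy′ = ≤-trans hy (*-monoʳ-≤ (3 * c) (bitLength-mono-≤ (⌈n/2⌉≤n k)))

lemma6 : Σ ℕ (λ C → ∀ k → k ≥ 1 → size (T k) ≤ C * k * ⌈log₂ (k + 1) ⌉)
    × (∀ k → k ≥ 1 → leaves (T k) ≡ k)
    × (∀ k → k ≥ 1 → ∀ s n → Desc (T k) s (suc n) → children s ≡ [] → suc n ≡ k)
lemma6 = (3 , size-bound) , T-leaves , λ k k≥1 s n → T-depth k k≥1 s (suc n)
  where
  size-bound : ∀ k → k ≥ 1 → size (T k) ≤ 3 * k * ⌈log₂ (k + 1) ⌉
  size-bound k k≥1 =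
    subst (λ l → size (T k) ≤ 3 * k * l) (cong ⌈log₂_⌉ (+-comm 1 k)) (T-size k k≥1)
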